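{- Let $(G,\mathsf m)$ be a marked graph and let $(K,\mathsf m_K)$ be its core. Then $$D_{(G,\mathsf m)}(\mathbf z,y)=D_{(K,\mathsf m_K)}(\mathbf z,y).$$
   Context: Graphs are finite and may have loops and multiple edges. A mark is a pair $(w,d)$ of integers with $w\ge1,d\ge0,w\ge d+1$, with dot-sum $(w,d)\dotplus(w',d')=(w+w',d+d'+1)$. A marked graph is $(G,\mathsf m)$ with $\mathsf m$ assigning a mark to each vertex; contracting a non-loop edge $e=uv$ merges $u,v$ into a new vertex (inheriting all other incident edges) with mark $\mathsf m(u)\dotplus\mathsf m(v)$. The $M$-polynomial $M_{(G,\mathsf m)}(\mathbf z,y)$ in commuting indeterminates $y$, $z_{w,d}$ is the well-defined polynomial given by: edgeless $G$ with marks $(w_i,d_i)$ gives $\prod_i z_{w_i,d_i}$; a loop $e$ gives $M_{(G,\mathsf m)}=y\,M_{(G\setminus e,\mathsf m)}$; a non-loop edge $e$ gives $M_{(G,\mathsf m)}=M_{(G\setminus e,\mathsf m)}+M_{(G/e,\mathsf m/e)}$. For a mark $(w,d)$ put $D_{\bullet_{w,d}}=\sum_{i=0}^d(-1)^i\binom di z_{w-i,0}z_{1,0}^i$; the $D$-polynomial $D_{(G,\mathsf m)}(\mathbf z,y)$ is obtained from $M_{(G,\mathsf m)}(\mathbf z,y)$ by substituting $z_{w,d}\mapsto D_{\bullet_{w,d}}$ for every mark $(w,d)$. A vertex is absorbable if it has degree $1$ and mark $(1,0)$; an edge is absorbable if it is incident with an absorbable vertex. Absorbing an absorbable edge $e=uv$,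 with $v$ absorbable and $\mathsf m(u)=(w,d)$, means contracting $e$ and giving the resulting vertex the mark $(w+1,d)$, all other marks unchanged. The core $(K,\mathsf m_K)$ of $(G,\mathsf m)$ is the marked graph obtained by absorbing absorbable edges until none remain. -}

module Defs where

open import Level using (Level)
open import Data.Nat using (ℕ; zero; suc; _+_; _∸_; _<_; _≤_; s≤s)
open import Data.Nat.Properties using (+-mono-≤; +-suc; m<n⇒m<1+n)
open import Data.Nat.Combinatorics using (_C_)
open import Data.Fin using (Fin; zero; suc; punchOut; punchIn; _≟_)
open import Data.Vec using (Vec; []; _∷_; map; lookup; removeAt)
open import Data.Product using (_×_; _,_; proj₁; proj₂; Σ)
open import Data.Sum using (_⊎_)
open import Relation.Nullary using (¬_; yes; no)
open import Relation.Binary.PropositionalEquality using (_≡_; _≢_; refl; sym; subst)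
open import Algebra.Bundles using (CommutativeRing)

record Mark : Set where
  constructor mark
  field
    w   : ℕ
    d   : ℕ
    d<w : d < w
open Mark public

private
  dotLemma : ∀ {w d w′ d′} → d < w → d′ < w′ → suc (d + d′) < w + w′
  dotLemma {w} {d} {w′} {d′} p q =
    subst (_≤ w + w′) (+-suc (suc d) d′) (+-mono-≤ p q)

_∔_ : Mark → Mark → Mark
mark w d p ∔ mark w′ d′ q = mark (w + w′) (suc (d + d′)) (dotLemma p q)

-- the mark (w + 1, d) given to a vertex that absorbs a pendant (1,0)-vertex
bump : Mark → Mark
bump (mark w d p) = mark (suc w) d (m<n⇒m<1+n p)

-- Marked graphs: vertex set Fin n, edges a vector of ordered pairs of
-- endpoints (loops = pairs (a , a); multiple edges allowed).

record Graph : Set where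
  constructor graph
  field
    {n}   : ℕ
    {k}   : ℕ
    marks : Fin n → Mark
    edges : Vec (Fin n × Fin n) k
open Graph public

-- Contraction of a non-loop edge uv : vertex v is merged into u.
-- The new vertex set is Fin m, the old vertex x ≠ v goes to punchOut x,
-- and v goes to (the image of) u.
merge : ∀ {m} (u v : Fin (suc m)) → u ≢ v → Fin (suc m) → Fin m
merge u v u≢v x with x ≟ v
... | yes _   = punchOut {i = v} {j = u} (λ e → u≢v (sym e))
... | no x≢v  = punchOut {i = v} {j = x} (λ e → x≢v (sym e))

mergeEdge : ∀ {m} (u v : Fin (suc m)) → u ≢ v →
            Fin (suc m) × Fin (suc m) → Fin m × Fin m
mergeEdge u v u≢v (a , b) = merge u v u≢v a , merge u v u≢v b

mergeMarks : ∀ {m} → (Fin (suc m) → Mark) → (u v : Fin (suc m)) →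
             Mark → Fin m → Mark
mergeMarks mk u v new y with punchIn v y ≟ u
... | yes _ = new
... | no  _ = mk (punchIn v y)

-- Evaluation of the M-polynomial in an arbitrary commutative ring
-- (z w d is the value of z_{w,d}, y the value of y).

module Poly {c ℓ : Level} (R : CommutativeRing c ℓ) where
  open CommutativeRing R using (Carrier; 0#; 1#) renaming (_+_ to _+ᴿ_; _*_ to _*ᴿ_; -_ to -ᴿ_)

  prodFin : ∀ {n} → (Fin n → Carrier) → Carrier
  prodFin {zero}  f = 1#
  prodFin {suc n} f = f zero *ᴿ prodFin (λ i → f (suc i))

  Mev : (z : ℕ → ℕ → Carrier) (y : Carrier) →
        ∀ {n} k → (Fin n → Mark) → Vec (Fin n × Fin n) k → Carrier
  Mev z y zero mk [] = prodFin (λ i → z (w (mk i)) (d (mk i)))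
  Mev z y {zero} (suc k) mk ((() , _) ∷ es)
  Mev z y {suc m} (suc k) mk ((a , b) ∷ es) with a ≟ b
  ... | yes _   = y *ᴿ Mev z y k mk es
  ... | no a≢b  = Mev z y k mk es
                +ᴿ Mev z y k (mergeMarks mk a b (mk a ∔ mk b))
                            (map (mergeEdge a b a≢b) es)

  M : (z : ℕ → ℕ → Carrier) (y : Carrier) → Graph → Carrier
  M z y G = Mev z y (k G) (marks G) (edges G)

  pow : Carrier → ℕ → Carrier
  pow x zero    = 1#
  pow x (suc i) = x *ᴿ pow x i

  fromℕ : ℕ → Carrier
  fromℕ zero    = 0#
  fromℕ (suc i) = 1# +ᴿ fromℕ i

  sumTo : ℕ → (ℕ → Carrier) → Carrier
  sumTo zero    f = f zero
  sumTo (suc d) f = sumTo d f +ᴿ f (suc d)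

  Dbullet : (z : ℕ → ℕ → Carrier) → ℕ → ℕ → Carrier
  Dbullet z w′ d′ = sumTo d′ (λ i →
    pow (-ᴿ 1#) i *ᴿ fromℕ (d′ C i) *ᴿ z (w′ ∸ i) 0 *ᴿ pow (z 1 0) i)

  D : (z : ℕ → ℕ → Carrier) (y : Carrier) → Graph → Carrier
  D z y G = M (Dbullet z) y G

-- contribution of an edge to the degree of v (a loop counts twice)
endCount : ∀ {n} → Fin n → Fin n × Fin n → ℕ
endCount v (a , b) = hit a + hit b
  where
  hit : _ → ℕ
  hit x with x ≟ v
  ... | yes _ = 1
  ... | no  _ = 0

degree : ∀ {n k} → Vec (Fin n × Fin n) k → Fin n → ℕ
degree [] v       = 0
degree (e ∷ es) v = endCount v e + degree es v

AbsorbableVertex : (G : Graph) → Fin (n G) → Set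
AbsorbableVertex G v =
  degree (edges G) v ≡ 1 × w (marks G v) ≡ 1 × d (marks G v) ≡ 0

AbsorbableEdge : (G : Graph) → Fin (k G) → Set
AbsorbableEdge G j =
  AbsorbableVertex G (proj₁ (lookup (edges G) j))
  ⊎ AbsorbableVertex G (proj₂ (lookup (edges G) j))

NoAbsorbable : Graph → Set
NoAbsorbable G = ∀ j → ¬ AbsorbableEdge G j

data AbsorbStep : Graph → Graph → Set where
  absorb : ∀ {m k} (mk : Fin (suc m) → Mark)
             (es : Vec (Fin (suc m) × Fin (suc m)) (suc k))
             (j : Fin (suc k)) (u v : Fin (suc m)) (u≢v : u ≢ v) →
           (lookup es j ≡ (u , v) ⊎ lookup es j ≡ (v , u)) →
           AbsorbableVertex (graph mk es) v →
           AbsorbStep (graph mk es)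
                      (graph (mergeMarks mk u v (bump (mk u)))
                             (map (mergeEdge u v u≢v) (removeAt es j)))

{-# OPTIONS --safe #-}
module Submission where

-- Absorbing a pendant vertex v of mark (1,0) into its neighbour u is deletion–contraction on the
-- edge e = uv.  In G ∖ e the vertex v is isolated and contributes the factor z_{1,0}, while G / e
-- gives u the mark m(u) ∔ (1,0) = (w+1,d+1).  As M is linear in the variable of a single vertex,
-- M(G ∖ e) + M(G / e) is M of the absorbed graph, in which u has mark (w+1,d), as soon as the
-- variables satisfy z_{w+1,d} = z_{w+1,d+1} + z_{1,0} z_{w,d}; for D_• this is Pascal's rule.
-- When e is not the first edge of the list, deletion–contraction of the first edge commutes with
-- the absorption (contracting and absorbing in either order give the same graph up to relabelling
-- the vertices, which M does not see), so we induct on the position of e.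

open import Defs
open import Level using (Level)
open import Algebra.Bundles using (CommutativeRing)
import Algebra.Properties.CommutativeMonoid.Sum as MonoidSum
import Algebra.Properties.Ring as RingProperties
import Algebra.Solver.Ring.NaturalCoefficients.Default as NatCoeffSolver
open import Data.Nat as ℕ using (ℕ; zero; suc; _∸_; _≤_; s≤s; z≤n)
import Data.Nat.Properties as ℕₚ
open import Data.Nat.Combinatorics using (_C_; nCk+nC[k+1]≡[n+1]C[k+1]; k>n⇒nCk≡0)
open import Data.Fin using (Fin; zero; suc; punchOut; punchIn; _≟_)
open import Data.Fin.Properties
  using (punchOut-cong; punchIn-punchOut; punchOut-punchIn; punchInᵢ≢i; suc-injective)
open import Data.Fin.Permutation as Perm
  using (Permutation′; permutation; _⟨$⟩ʳ_; _⟨$⟩ˡ_; inverseˡ; inverseʳ)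
open import Data.Vec using (Vec; []; _∷_; map; lookup; removeAt)
open import Data.Vec.Properties using (map-∘; map-cong; map-id; lookup-map)
open import Data.Product using (_×_; _,_; proj₁; proj₂; map₁)
open import Data.Sum using (_⊎_; inj₁; inj₂)
import Data.Sum as Sum
open import Function using (_∘_; id)
open import Relation.Nullary using (¬_; Dec; yes; no)
open import Relation.Nullary.Decidable using (_⊎-dec_)
open import Relation.Nullary.Negation using (contradiction)
open import Relation.Binary.PropositionalEquality
  using (_≡_; _≢_; refl; sym; trans; cong; cong₂; subst)
open import Relation.Binary.Construct.Closure.ReflexiveTransitive using (Star; ε; _◅_)

_∈₂_ : ∀ {n} → Fin n → Fin n × Fin n → Set
x ∈₂ (a , b) = x ≡ a ⊎ x ≡ b

_∈₂?_ : ∀ {n} (x : Fin n) (e : Fin n × Fin n) → Dec (x ∈₂ e)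
x ∈₂? (a , b) = (x ≟ a) ⊎-dec (x ≟ b)

∈₂-swap : ∀ {n} {x a b : Fin n} → x ∈₂ (a , b) → x ∈₂ (b , a)
∈₂-swap (inj₁ x≡a) = inj₂ x≡a
∈₂-swap (inj₂ x≡b) = inj₁ x≡b

Joins : ∀ {n} → Fin n → Fin n → Fin n × Fin n → Set
Joins u v e = e ≡ (u , v) ⊎ e ≡ (v , u)

mapEdge : ∀ {n n′} → (Fin n → Fin n′) → Fin n × Fin n → Fin n′ × Fin n′
mapEdge f (a , b) = f a , f b

KernelSub : ∀ {A B C : Set} → (A → B) → (A → C) → Set
KernelSub g h = ∀ {x x′} → g x ≡ g x′ → h x ≡ h x′

contractMarks absorbMarks : ∀ {m} → (Fin (suc m) → Mark) → (u v : Fin (suc m)) → Fin m → Mark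
contractMarks mk u v = mergeMarks mk u v (mk u ∔ mk v)
absorbMarks   mk u v = mergeMarks mk u v (bump (mk u))

contractEdges : ∀ {m k} (u v : Fin (suc m)) → u ≢ v →
                Vec (Fin (suc m) × Fin (suc m)) k → Vec (Fin m × Fin m) k
contractEdges u v u≢v = map (mergeEdge u v u≢v)

merge-irrelevant : ∀ {m} (u v : Fin (suc m)) (p q : u ≢ v) x → merge u v p x ≡ merge u v q x
merge-irrelevant u v p q x with x ≟ v
... | yes _ = punchOut-cong v refl
... | no  _ = punchOut-cong v refl

mergeMarks-≡ : ∀ {m} mk (u v : Fin (suc m)) N y → punchIn v y ≡ u → mergeMarks mk u v N y ≡ N
mergeMarks-≡ mk u v N y e with punchIn v y ≟ u
... | yes _ = refl
... | no ne = contradiction e ne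

mergeMarks-≢ : ∀ {m} mk (u v : Fin (suc m)) N y → punchIn v y ≢ u →
               mergeMarks mk u v N y ≡ mk (punchIn v y)
mergeMarks-≢ mk u v N y ne with punchIn v y ≟ u
... | yes e = contradiction e ne
... | no  _ = refl

module _ {m : ℕ} (u v : Fin (suc m)) (u≢v : u ≢ v) where

  private
    π = merge u v u≢v

  merge-v : π v ≡ punchOut (u≢v ∘ sym)
  merge-v with v ≟ v
  ... | yes _   = refl
  ... | no  v≢v = contradiction refl v≢v

  merge-≢v : ∀ {x} (x≢v : x ≢ v) → π x ≡ punchOut (x≢v ∘ sym)
  merge-≢v {x} x≢v with x ≟ v
  ... | yes x≡v = contradiction x≡v x≢v
  ... | no  _   = punchOut-cong v refl

  merge-punchIn : ∀ y → π (punchIn v y) ≡ y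
  merge-punchIn y = trans (merge-≢v (punchInᵢ≢i v y)) (punchOut-punchIn v)

  punchIn-merge-v : punchIn v (π v) ≡ u
  punchIn-merge-v = trans (cong (punchIn v) merge-v) (punchIn-punchOut _)

  punchIn-merge-≢v : ∀ {x} → x ≢ v → punchIn v (π x) ≡ x
  punchIn-merge-≢v x≢v = trans (cong (punchIn v) (merge-≢v x≢v)) (punchIn-punchOut _)

  merge-u≡merge-v : π u ≡ π v
  merge-u≡merge-v = trans (merge-≢v u≢v) (trans (punchOut-cong v refl) (sym merge-v))

  merge-∈₂ : ∀ {x} → x ∈₂ (u , v) → π x ≡ π u
  merge-∈₂ (inj₁ refl) = refl
  merge-∈₂ (inj₂ refl) = sym merge-u≡merge-v

  merge-kernel : ∀ {x x′} → π x ≡ π x′ → x ≡ x′ ⊎ (x ∈₂ (u , v) × x′ ∈₂ (u , v))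
  merge-kernel {x} {x′} e = cases (x ≟ v) (x′ ≟ v)
    where
    cases : Dec (x ≡ v) → Dec (x′ ≡ v) → x ≡ x′ ⊎ (x ∈₂ (u , v) × x′ ∈₂ (u , v))
    cases (yes x≡v) (yes x′≡v) = inj₂ (inj₂ x≡v , inj₂ x′≡v)
    cases (yes x≡v) (no  x′≢v) = inj₂ (inj₂ x≡v , inj₁ (sym (trans (sym punchIn-merge-v)
      (trans (cong (punchIn v ∘ π) (sym x≡v)) (trans (cong (punchIn v) e) (punchIn-merge-≢v x′≢v))))))
    cases (no  x≢v) (yes x′≡v) = inj₂ (inj₁ (trans (sym (punchIn-merge-≢v x≢v))
      (trans (cong (punchIn v) e) (trans (cong (punchIn v ∘ π) x′≡v) punchIn-merge-v))) , inj₂ x′≡v)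
    cases (no  x≢v) (no  x′≢v) =
      inj₁ (trans (sym (punchIn-merge-≢v x≢v)) (trans (cong (punchIn v) e) (punchIn-merge-≢v x′≢v)))

  merge-injective-∉ : ∀ {x x′} → ¬ x ∈₂ (u , v) → π x ≡ π x′ → x ≡ x′
  merge-injective-∉ x∉ e with merge-kernel e
  ... | inj₁ x≡x′     = x≡x′
  ... | inj₂ (x∈ , _) = contradiction x∈ x∉

  merge-factor : ∀ {A : Set} (h : Fin (suc m) → A) → h u ≡ h v → KernelSub π h
  merge-factor h hu≡hv {x} {x′} e with merge-kernel {x} {x′} e
  ... | inj₁ refl                    = refl
  ... | inj₂ (inj₁ refl , inj₁ refl) = refl
  ... | inj₂ (inj₁ refl , inj₂ refl) = hu≡hv
  ... | inj₂ (inj₂ refl , inj₁ refl) = sym hu≡hv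
  ... | inj₂ (inj₂ refl , inj₂ refl) = refl

  merge-factor-punchIn : ∀ {A : Set} (h : Fin (suc m) → A) → h u ≡ h v →
                         ∀ x → h (punchIn v (π x)) ≡ h x
  merge-factor-punchIn h hu≡hv x = merge-factor h hu≡hv (merge-punchIn (π x))

  mergeMarks-∈ : ∀ mk N {x} → x ∈₂ (u , v) → mergeMarks mk u v N (π x) ≡ N
  mergeMarks-∈ mk N {x} x∈ = mergeMarks-≡ mk u v N (π x) (rep x∈)
    where
    rep : x ∈₂ (u , v) → punchIn v (π x) ≡ u
    rep (inj₁ refl) = trans (cong (punchIn v) merge-u≡merge-v) punchIn-merge-v
    rep (inj₂ refl) = punchIn-merge-v

  mergeMarks-∉ : ∀ mk N {x} → ¬ x ∈₂ (u , v) → mergeMarks mk u v N (π x) ≡ mk x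
  mergeMarks-∉ mk N {x} x∉ =
    trans (mergeMarks-≢ mk u v N (π x) (λ e → x∉ (inj₁ (trans (sym rep) e)))) (cong mk rep)
    where
    rep : punchIn v (π x) ≡ x
    rep = punchIn-merge-≢v (x∉ ∘ inj₂)

merge-suc : ∀ {m} {a b : Fin (suc m)} (a≢b : a ≢ b) (sa≢sb : suc a ≢ suc b) x →
            merge (suc a) (suc b) sa≢sb (suc x) ≡ suc (merge a b a≢b x)
merge-suc {a = a} {b} a≢b sa≢sb x = cases (x ≟ b)
  where
  cases : Dec (x ≡ b) → merge (suc a) (suc b) sa≢sb (suc x) ≡ suc (merge a b a≢b x)
  cases (yes refl) = trans (merge-v (suc a) (suc x) sa≢sb)
                           (cong suc (trans (punchOut-cong x refl) (sym (merge-v a x a≢b))))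
  cases (no  x≢b)  = trans (merge-≢v (suc a) (suc b) sa≢sb (x≢b ∘ suc-injective))
                           (cong suc (trans (punchOut-cong b refl) (sym (merge-≢v a b a≢b x≢b))))

mergeMarks-suc : ∀ {m} mk (a b : Fin (suc m)) N y →
                 mergeMarks mk (suc a) (suc b) N (suc y) ≡ mergeMarks (mk ∘ suc) a b N y
mergeMarks-suc mk a b N y = cases (punchIn b y ≟ a)
  where
  cases : Dec (punchIn b y ≡ a) → mergeMarks mk (suc a) (suc b) N (suc y) ≡ mergeMarks (mk ∘ suc) a b N y
  cases (yes e)  = trans (mergeMarks-≡ mk (suc a) (suc b) N (suc y) (cong suc e))
                         (sym (mergeMarks-≡ (mk ∘ suc) a b N y e))
  cases (no  ne) = trans (mergeMarks-≢ mk (suc a) (suc b) N (suc y) (ne ∘ suc-injective))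
                         (sym (mergeMarks-≢ (mk ∘ suc) a b N y ne))

mergeMarks-zero : ∀ {m} mk (a b : Fin (suc m)) N → mergeMarks mk (suc a) (suc b) N zero ≡ mk zero
mergeMarks-zero mk a b N = mergeMarks-≢ mk (suc a) (suc b) N zero λ ()

module _ {m : ℕ} (mk : Fin (suc m) → Mark) {u v : Fin (suc m)} (u≢v : u ≢ v) where

  mergeMarks-self : ∀ i → mergeMarks mk u v (mk u) i ≡ mk (punchIn v i)
  mergeMarks-self i with punchIn v i ≟ u
  ... | yes e = cong mk (sym e)
  ... | no  _ = refl

  mergeMarks-off : ∀ N N′ {i} → i ≢ merge u v u≢v u → mergeMarks mk u v N i ≡ mergeMarks mk u v N′ i
  mergeMarks-off N N′ {i} i≢ with punchIn v i ≟ u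
  ... | yes e = contradiction (trans (sym (merge-punchIn u v u≢v i)) (cong (merge u v u≢v) e)) i≢
  ... | no  _ = refl

merge²-factor : ∀ {m} {A : Set} {x₀ y₀ : Fin (suc (suc m))} (q : x₀ ≢ y₀) {c₀ d₀}
                (r : merge x₀ y₀ q c₀ ≢ merge x₀ y₀ q d₀) (H : Fin (suc (suc m)) → A) →
                H x₀ ≡ H y₀ → H c₀ ≡ H d₀ →
                KernelSub (merge (merge x₀ y₀ q c₀) (merge x₀ y₀ q d₀) r ∘ merge x₀ y₀ q) H
merge²-factor {x₀ = x₀} {y₀} q {c₀} {d₀} r H H-x₀y₀ H-c₀d₀ {x} {x′} e =
  trans (sym (H′ x)) (trans (merge-factor _ _ r (H ∘ punchIn y₀) H′-c₀d₀ e) (H′ x′))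
  where
  H′ : ∀ x → H (punchIn y₀ (merge x₀ y₀ q x)) ≡ H x
  H′ = merge-factor-punchIn x₀ y₀ q H H-x₀y₀
  H′-c₀d₀ : H (punchIn y₀ (merge x₀ y₀ q c₀)) ≡ H (punchIn y₀ (merge x₀ y₀ q d₀))
  H′-c₀d₀ = trans (H′ c₀) (trans H-c₀d₀ (sym (H′ d₀)))

removeAt-map : ∀ {A B : Set} {k} (f : A → B) (xs : Vec A (suc k)) (j : Fin (suc k)) →
               removeAt (map f xs) j ≡ map f (removeAt xs j)
removeAt-map f (x ∷ xs)     zero    = refl
removeAt-map f (x ∷ y ∷ xs) (suc j) = cong (f x ∷_) (removeAt-map f (y ∷ xs) j)

mark-≡ : ∀ {μ ν : Mark} → w μ ≡ w ν → d μ ≡ d ν → μ ≡ ν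
mark-≡ {mark w₁ d₁ p} {mark _ _ q} refl refl = cong (mark w₁ d₁) (ℕₚ.≤-irrelevant p q)

∔-comm : ∀ μ ν → μ ∔ ν ≡ ν ∔ μ
∔-comm μ ν = mark-≡ (ℕₚ.+-comm (w μ) (w ν)) (cong suc (ℕₚ.+-comm (d μ) (d ν)))

bump-∔ˡ : ∀ μ ν → bump μ ∔ ν ≡ bump (μ ∔ ν)
bump-∔ˡ μ ν = mark-≡ refl refl

bump-∔ʳ : ∀ μ ν → μ ∔ bump ν ≡ bump (μ ∔ ν)
bump-∔ʳ μ ν = mark-≡ (ℕₚ.+-suc (w μ) (w ν)) refl

-- The marks of the recurrence D_{W+1,D} = D_{W+1,D+1} + z_{1,0} D_{W,D}:
-- μ = (W+1 , D), μ⁺ = (W+1 , D+1), μ⁻ = (W , D).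
record Split (μ μ⁺ μ⁻ : Mark) : Set where
  constructor mkSplit
  field
    w-μ  : w μ ≡ suc (w μ⁻)
    d-μ  : d μ ≡ d μ⁻
    w-μ⁺ : w μ⁺ ≡ w μ
    d-μ⁺ : d μ⁺ ≡ suc (d μ)

Split-resp : ∀ {μ μ⁺ μ⁻ ν ν⁺ ν⁻} → μ ≡ ν → μ⁺ ≡ ν⁺ → μ⁻ ≡ ν⁻ →
             Split μ μ⁺ μ⁻ → Split ν ν⁺ ν⁻
Split-resp refl refl refl s = s

Split-∔ʳ : ∀ {μ μ⁺ μ⁻} ν → Split μ μ⁺ μ⁻ → Split (μ ∔ ν) (μ⁺ ∔ ν) (μ⁻ ∔ ν)
Split-∔ʳ ν (mkSplit w-μ d-μ w-μ⁺ d-μ⁺) = mkSplit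
  (cong (ℕ._+ w ν) w-μ)  (cong (λ t → suc (t ℕ.+ d ν)) d-μ)
  (cong (ℕ._+ w ν) w-μ⁺) (cong (λ t → suc (t ℕ.+ d ν)) d-μ⁺)

Split-∔ˡ : ∀ {μ μ⁺ μ⁻} ν → Split μ μ⁺ μ⁻ → Split (ν ∔ μ) (ν ∔ μ⁺) (ν ∔ μ⁻)
Split-∔ˡ {μ} {μ⁺} {μ⁻} ν s =
  Split-resp (∔-comm μ ν) (∔-comm μ⁺ ν) (∔-comm μ⁻ ν) (Split-∔ʳ ν s)

record SplitAt {n} (x : Fin n) (mk mk⁺ mk⁻ : Fin n → Mark) : Set where
  field
    at    : Split (mk x) (mk⁺ x) (mk⁻ x)
    off⁺  : ∀ {i} → i ≢ x → mk⁺ i ≡ mk i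
    off⁻  : ∀ {i} → i ≢ x → mk⁻ i ≡ mk i

module _ {m : ℕ} {a b : Fin (suc m)} (a≢b : a ≢ b) where

  private
    π = merge a b a≢b

  contractMarks-agreeOff : ∀ {x} {mk mk′ : Fin (suc m) → Mark} → (∀ {i} → i ≢ x → mk′ i ≡ mk i) →
                           ∀ {i} → i ≢ π x → contractMarks mk′ a b i ≡ contractMarks mk a b i
  contractMarks-agreeOff {x} {mk} {mk′} agree {i} i≢πx =
    subst (λ t → contractMarks mk′ a b t ≡ contractMarks mk a b t) (merge-punchIn a b a≢b i)
          (agree-π (y ∈₂? (a , b)))
    where
    y = punchIn b i
    ≢x : ∀ {t} → π t ≡ π y → t ≢ x
    ≢x πt≡πy t≡x = i≢πx (trans (sym (merge-punchIn a b a≢b i)) (trans (sym πt≡πy) (cong π t≡x)))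
    agree-π : Dec (y ∈₂ (a , b)) → contractMarks mk′ a b (π y) ≡ contractMarks mk a b (π y)
    agree-π (yes y∈) = trans (mergeMarks-∈ a b a≢b mk′ _ y∈) (trans
      (cong₂ _∔_ (agree (≢x πa≡πy)) (agree (≢x (trans (merge-∈₂ a b a≢b (inj₂ refl)) πa≡πy))))
      (sym (mergeMarks-∈ a b a≢b mk _ y∈)))
      where
      πa≡πy : π a ≡ π y
      πa≡πy = sym (merge-∈₂ a b a≢b y∈)
    agree-π (no  y∉) =
      trans (mergeMarks-∉ a b a≢b mk′ _ y∉)
            (trans (agree (≢x refl)) (sym (mergeMarks-∉ a b a≢b mk _ y∉)))

  SplitAt-contract : ∀ {x mk mk⁺ mk⁻} → SplitAt x mk mk⁺ mk⁻ →
    SplitAt (π x) (contractMarks mk a b) (contractMarks mk⁺ a b) (contractMarks mk⁻ a b)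
  SplitAt-contract {x} {mk} {mk⁺} {mk⁻} s = record
    { at    = split-π (x ∈₂? (a , b))
    ; off⁺  = contractMarks-agreeOff off⁺
    ; off⁻  = contractMarks-agreeOff off⁻
    }
    where
    open SplitAt s
    contracted : (Fin (suc m) → Mark) → Mark
    contracted mk′ = contractMarks mk′ a b (π x)
    contracted-∈ : x ∈₂ (a , b) → ∀ mk′ → contracted mk′ ≡ mk′ a ∔ mk′ b
    contracted-∈ x∈ mk′ = mergeMarks-∈ a b a≢b mk′ _ x∈
    split-π : Dec (x ∈₂ (a , b)) → Split (contracted mk) (contracted mk⁺) (contracted mk⁻)
    split-π (yes x∈@(inj₁ refl)) = Split-resp
      (sym (contracted-∈ x∈ mk))
      (sym (trans (contracted-∈ x∈ mk⁺) (cong (mk⁺ a ∔_) (off⁺ (a≢b ∘ sym)))))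
      (sym (trans (contracted-∈ x∈ mk⁻) (cong (mk⁻ a ∔_) (off⁻ (a≢b ∘ sym)))))
      (Split-∔ʳ (mk b) at)
    split-π (yes x∈@(inj₂ refl)) = Split-resp
      (sym (contracted-∈ x∈ mk))
      (sym (trans (contracted-∈ x∈ mk⁺) (cong (_∔ mk⁺ b) (off⁺ a≢b))))
      (sym (trans (contracted-∈ x∈ mk⁻) (cong (_∔ mk⁻ b) (off⁻ a≢b))))
      (Split-∔ˡ (mk a) at)
    split-π (no x∉) = Split-resp
      (sym (mergeMarks-∉ a b a≢b mk _ x∉))
      (sym (mergeMarks-∉ a b a≢b mk⁺ _ x∉))
      (sym (mergeMarks-∉ a b a≢b mk⁻ _ x∉))
      at

Split-absorb : ∀ {μ ν} → w ν ≡ 1 → d ν ≡ 0 → Split (bump μ) (μ ∔ ν) μ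
Split-absorb {μ} refl refl = mkSplit refl refl (ℕₚ.+-comm (w μ) 1) (cong suc (ℕₚ.+-identityʳ (d μ)))

-- Surjections with a common kernel
record SameQuotient {N M : ℕ} (g₁ g₂ : Fin N → Fin M) : Set where
  field
    section₁    : Fin M → Fin N
    section₂    : Fin M → Fin N
    g₁∘section₁ : ∀ y → g₁ (section₁ y) ≡ y
    g₂∘section₂ : ∀ y → g₂ (section₂ y) ≡ y
    ker₁₂       : KernelSub g₁ g₂
    ker₂₁       : KernelSub g₂ g₁

module _ {N M : ℕ} {g₁ g₂ : Fin N → Fin M} (Q : SameQuotient g₁ g₂) where
  open SameQuotient Q

  kernelPermutation : Permutation′ M
  kernelPermutation = permutation (g₂ ∘ section₁) (g₁ ∘ section₂)
    (λ y → trans (ker₁₂ (g₁∘section₁ (g₁ (section₂ y)))) (g₂∘section₂ y))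
    (λ y → trans (ker₂₁ (g₂∘section₂ (g₂ (section₁ y)))) (g₁∘section₁ y))

KernelSub-contract : ∀ {N M} {g g′ : Fin N → Fin (suc M)} {s : Fin (suc M) → Fin N} →
                     (∀ y → g (s y) ≡ y) → KernelSub g g′ →
                     ∀ {a b} (q : g a ≢ g b) (q′ : g′ a ≢ g′ b) →
                     KernelSub (merge (g a) (g b) q ∘ g) (merge (g′ a) (g′ b) q′ ∘ g′)
KernelSub-contract {N} {M} {g} {g′} {s} g∘s ker {a} {b} q q′ {x} {x′} e =
  trans (sym (back x)) (trans (merge-factor (g a) (g b) q (H ∘ s) Hs-ab e) (back x′))
  where
  H : Fin N → Fin M
  H = merge (g′ a) (g′ b) q′ ∘ g′
  back : ∀ x → H (s (g x)) ≡ H x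
  back x = cong (merge (g′ a) (g′ b) q′) (ker (g∘s (g x)))
  Hs-ab : H (s (g a)) ≡ H (s (g b))
  Hs-ab = trans (back a) (trans (merge-u≡merge-v (g′ a) (g′ b) q′) (sym (back b)))

module _ {N M : ℕ} {g₁ g₂ : Fin N → Fin (suc M)} (Q : SameQuotient g₁ g₂)
         {a b : Fin N} (p₁ : g₁ a ≢ g₁ b) (p₂ : g₂ a ≢ g₂ b) where
  open SameQuotient Q

  SameQuotient-contract : SameQuotient (merge (g₁ a) (g₁ b) p₁ ∘ g₁) (merge (g₂ a) (g₂ b) p₂ ∘ g₂)
  SameQuotient-contract = record
    { section₁    = section₁ ∘ punchIn (g₁ b)
    ; section₂    = section₂ ∘ punchIn (g₂ b)
    ; g₁∘section₁ = λ y → trans (cong (merge _ _ p₁) (g₁∘section₁ _)) (merge-punchIn _ _ p₁ y)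
    ; g₂∘section₂ = λ y → trans (cong (merge _ _ p₂) (g₂∘section₂ _)) (merge-punchIn _ _ p₂ y)
    ; ker₁₂       = λ {x x′} → KernelSub-contract g₁∘section₁ ker₁₂ p₁ p₂ {x} {x′}
    ; ker₂₁       = λ {x x′} → KernelSub-contract g₂∘section₂ ker₂₁ p₂ p₁ {x} {x′}
    }

  contractMarks-compatible : ∀ {mA mB : Fin (suc M) → Mark} → (∀ x → mB (g₂ x) ≡ mA (g₁ x)) →
    ∀ x →
    contractMarks mB (g₂ a) (g₂ b) (merge _ _ p₂ (g₂ x)) ≡
    contractMarks mA (g₁ a) (g₁ b) (merge _ _ p₁ (g₁ x))
  contractMarks-compatible {mA} {mB} marks x with g₁ x ∈₂? (g₁ a , g₁ b)
  ... | yes x∈ = trans (mergeMarks-∈ _ _ p₂ mB _ (to₂ x∈))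
                   (trans (cong₂ _∔_ (marks a) (marks b)) (sym (mergeMarks-∈ _ _ p₁ mA _ x∈)))
    where
    to₂ : g₁ x ∈₂ (g₁ a , g₁ b) → g₂ x ∈₂ (g₂ a , g₂ b)
    to₂ (inj₁ e) = inj₁ (ker₁₂ e)
    to₂ (inj₂ e) = inj₂ (ker₁₂ e)
  ... | no  x∉ = trans (mergeMarks-∉ _ _ p₂ mB _ (x∉ ∘ to₁))
                   (trans (marks x) (sym (mergeMarks-∉ _ _ p₁ mA _ x∉)))
    where
    to₁ : g₂ x ∈₂ (g₂ a , g₂ b) → g₁ x ∈₂ (g₁ a , g₁ b)
    to₁ (inj₁ e) = inj₁ (ker₂₁ e)
    to₁ (inj₂ e) = inj₂ (ker₂₁ e)

SameQuotient-permutation : ∀ {n} (σ : Permutation′ n) → SameQuotient id (σ ⟨$⟩ʳ_)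
SameQuotient-permutation σ = record
  { section₁    = id
  ; section₂    = σ ⟨$⟩ˡ_
  ; g₁∘section₁ = λ _ → refl
  ; g₂∘section₂ = λ _ → inverseʳ σ
  ; ker₁₂       = cong (σ ⟨$⟩ʳ_)
  ; ker₂₁       = λ e → trans (sym (inverseˡ σ)) (trans (cong (σ ⟨$⟩ˡ_) e) (inverseˡ σ))
  }

SameQuotient-swap : ∀ {m} {u v : Fin (suc m)} (u≢v : u ≢ v) → SameQuotient (merge v u (u≢v ∘ sym)) (merge u v u≢v)
SameQuotient-swap {u = u} {v} u≢v = record
  { section₁    = punchIn u
  ; section₂    = punchIn v
  ; g₁∘section₁ = merge-punchIn v u (u≢v ∘ sym)
  ; g₂∘section₂ = merge-punchIn u v u≢v
  ; ker₁₂       = λ {x x′} →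
      merge-factor v u (u≢v ∘ sym) (merge u v u≢v) (sym (merge-u≡merge-v u v u≢v)) {x} {x′}
  ; ker₂₁       = λ {x x′} →
      merge-factor u v u≢v (merge v u (u≢v ∘ sym)) (sym (merge-u≡merge-v v u (u≢v ∘ sym))) {x} {x′}
  }

module _ {m : ℕ} (mk : Fin (suc m) → Mark) {u v : Fin (suc m)} (u≢v : u ≢ v) where

  contractMarks-swap : ∀ x → contractMarks mk u v (merge u v u≢v x) ≡
                             contractMarks mk v u (merge v u (u≢v ∘ sym) x)
  contractMarks-swap x with x ∈₂? (u , v)
  ... | yes x∈ = trans (mergeMarks-∈ u v u≢v mk _ x∈)
                   (trans (∔-comm (mk u) (mk v)) (sym (mergeMarks-∈ v u (u≢v ∘ sym) mk _ (∈₂-swap x∈))))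
  ... | no  x∉ = trans (mergeMarks-∉ u v u≢v mk _ x∉)
                       (sym (mergeMarks-∉ v u (u≢v ∘ sym) mk _ (x∉ ∘ ∈₂-swap)))

hit : ∀ {n} → Fin n → Fin n → ℕ
hit v x with x ≟ v
... | yes _ = 1
... | no  _ = 0

hit-≡ : ∀ {n} {v x : Fin n} → x ≡ v → hit v x ≡ 1
hit-≡ {v = v} {x} x≡v with x ≟ v
... | yes _   = refl
... | no  x≢v = contradiction x≡v x≢v

hit-≢ : ∀ {n} {v x : Fin n} → x ≢ v → hit v x ≡ 0
hit-≢ {v = v} {x} x≢v with x ≟ v
... | yes x≡v = contradiction x≡v x≢v
... | no  _   = refl

hit≡0⇒≢ : ∀ {n} {v x : Fin n} → hit v x ≡ 0 → x ≢ v
hit≡0⇒≢ h x≡v with () ← trans (sym (hit-≡ x≡v)) h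

endCount-hit : ∀ {n} (v : Fin n) e → endCount v e ≡ hit v (proj₁ e) ℕ.+ hit v (proj₂ e)
endCount-hit v (a , b) with a ≟ v | b ≟ v
... | yes _ | yes _ = refl
... | yes _ | no  _ = refl
... | no  _ | yes _ = refl
... | no  _ | no  _ = refl

endCount-joins : ∀ {n} {u v : Fin n} → u ≢ v → ∀ {e} → Joins u v e → endCount v e ≡ 1
endCount-joins {u = u} {v} u≢v (inj₁ refl) =
  trans (endCount-hit v (u , v)) (cong₂ ℕ._+_ (hit-≢ u≢v) (hit-≡ {v = v} refl))
endCount-joins {u = u} {v} u≢v (inj₂ refl) =
  trans (endCount-hit v (v , u)) (cong₂ ℕ._+_ (hit-≡ {v = v} refl) (hit-≢ u≢v))

endCount≡0⇒∉ : ∀ {n} {v : Fin n} e → endCount v e ≡ 0 → ¬ v ∈₂ e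
endCount≡0⇒∉ {v = v} (a , b) h v∈ with v∈
... | inj₁ v≡a = hit≡0⇒≢ (ℕₚ.m+n≡0⇒m≡0 (hit v a) h′) (sym v≡a)
  where h′ = trans (sym (endCount-hit v (a , b))) h
... | inj₂ v≡b = hit≡0⇒≢ (ℕₚ.m+n≡0⇒n≡0 (hit v a) h′) (sym v≡b)
  where h′ = trans (sym (endCount-hit v (a , b))) h

joins⇒degree-pos : ∀ {n k} {u v : Fin n} → u ≢ v → (es : Vec (Fin n × Fin n) k) (j : Fin k) →
                   Joins u v (lookup es j) → 1 ≤ degree es v
joins⇒degree-pos {v = v} u≢v (e ∷ es) zero    uv =
  subst (λ t → 1 ≤ t ℕ.+ degree es v) (sym (endCount-joins u≢v uv)) (s≤s z≤n)
joins⇒degree-pos {v = v} u≢v (e ∷ es) (suc j) uv =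
  ℕₚ.≤-trans (joins⇒degree-pos u≢v es j uv) (ℕₚ.m≤n+m _ (endCount v e))

degree-map : ∀ {n n′ k} (f : Fin n → Fin n′) {v : Fin n} {v′ : Fin n′} →
             f v ≡ v′ → (∀ {x} → f x ≡ v′ → x ≡ v) →
             (es : Vec (Fin n × Fin n) k) → degree (map (mapEdge f) es) v′ ≡ degree es v
degree-map f fv≡v′ f⁻¹v′ []             = refl
degree-map f {v} {v′} fv≡v′ f⁻¹v′ ((a , b) ∷ es) = cong₂ ℕ._+_
  (trans (endCount-hit v′ (f a , f b))
         (trans (cong₂ ℕ._+_ (hit-map a) (hit-map b)) (sym (endCount-hit v (a , b)))))
  (degree-map f fv≡v′ f⁻¹v′ es)
  where
  hit-map : ∀ x → hit v′ (f x) ≡ hit v x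
  hit-map x with x ≟ v
  ... | yes x≡v = hit-≡ (trans (cong f x≡v) fv≡v′)
  ... | no  x≢v = hit-≢ (x≢v ∘ f⁻¹v′)

degree≡0⇒avoids : ∀ {m k} {u v : Fin (suc m)} (u≢v : u ≢ v) (es : Vec (Fin (suc m) × Fin (suc m)) k) →
                  degree es v ≡ 0 → es ≡ map (mapEdge (punchIn v)) (contractEdges u v u≢v es)
degree≡0⇒avoids u≢v []             h = refl
degree≡0⇒avoids {u = u} {v} u≢v ((a , b) ∷ es) h = cong₂ _∷_
  (cong₂ _,_ (sym (punchIn-merge-≢v u v u≢v (v∉ ∘ inj₁ ∘ sym)))
             (sym (punchIn-merge-≢v u v u≢v (v∉ ∘ inj₂ ∘ sym))))
  (degree≡0⇒avoids u≢v es (ℕₚ.m+n≡0⇒n≡0 (endCount v (a , b)) h))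
  where
  v∉ : ¬ v ∈₂ (a , b)
  v∉ = endCount≡0⇒∉ (a , b) (ℕₚ.m+n≡0⇒m≡0 _ h)

pendant-head : ∀ {n k} {u v : Fin n} {e} (es : Vec (Fin n × Fin n) k) → u ≢ v → Joins u v e →
               degree (e ∷ es) v ≡ 1 → degree es v ≡ 0
pendant-head {v = v} es u≢v uv deg =
  ℕₚ.suc-injective (trans (cong (ℕ._+ degree es v) (sym (endCount-joins u≢v uv))) deg)

pendant-tail : ∀ {n k} {u v : Fin n} e (es : Vec (Fin n × Fin n) k) (j : Fin k) → u ≢ v →
               Joins u v (lookup es j) → degree (e ∷ es) v ≡ 1 → ¬ v ∈₂ e × degree es v ≡ 1
pendant-tail {v = v} e es j u≢v uv deg =
  map₁ (endCount≡0⇒∉ e) (split (endCount v e) (joins⇒degree-pos u≢v es j uv) deg)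
  where
  split : ∀ m {n} → 1 ≤ n → m ℕ.+ n ≡ 1 → m ≡ 0 × n ≡ 1
  split zero    _ h = refl , h
  split (suc m) {suc n} _ h with () ← ℕₚ.m+n≡0⇒n≡0 m (ℕₚ.suc-injective h)

-- Absorbing a pendant vertex commutes with contracting another edge
module AbsorbContract {m : ℕ} (mk : Fin (suc (suc m)) → Mark) {a b u v : Fin (suc (suc m))}
                      (a≢b : a ≢ b) (u≢v : u ≢ v) (v∉ab : ¬ v ∈₂ (a , b)) where

  -- h contracts ab and g absorbs v into u; g₁ and mA apply h first, g₂ and mB apply g first.
  h g : Fin (suc (suc m)) → Fin (suc m)
  h = merge a b a≢b
  g = merge u v u≢v

  h-fibre-v : ∀ {x} → h x ≡ h v → x ≡ v
  h-fibre-v e = sym (merge-injective-∉ a b a≢b v∉ab (sym e))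

  hu≢hv : h u ≢ h v
  hu≢hv = u≢v ∘ h-fibre-v

  ga≢gb : g a ≢ g b
  ga≢gb e with merge-kernel u v u≢v e
  ... | inj₁ a≡b                         = a≢b a≡b
  ... | inj₂ (inj₁ a≡u , inj₁ b≡u)       = a≢b (trans a≡u (sym b≡u))
  ... | inj₂ (inj₂ a≡v , _)              = v∉ab (inj₁ (sym a≡v))
  ... | inj₂ (_        , inj₂ b≡v)       = v∉ab (inj₂ (sym b≡v))

  g₁ g₂ : Fin (suc (suc m)) → Fin m
  g₁ = merge (h u) (h v) hu≢hv ∘ h
  g₂ = merge (g a) (g b) ga≢gb ∘ g

  sameQuotient : SameQuotient g₁ g₂
  sameQuotient = record
    { section₁    = punchIn b ∘ punchIn (h v)
    ; section₂    = punchIn v ∘ punchIn (g b)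
    ; g₁∘section₁ = λ y →
        trans (cong (merge _ _ hu≢hv) (merge-punchIn a b a≢b _)) (merge-punchIn _ _ hu≢hv y)
    ; g₂∘section₂ = λ y →
        trans (cong (merge _ _ ga≢gb) (merge-punchIn u v u≢v _)) (merge-punchIn _ _ ga≢gb y)
    ; ker₁₂       = λ {x x′} → merge²-factor a≢b {u} {v} hu≢hv g₂ (merge-u≡merge-v _ _ ga≢gb)
                                   (cong (merge _ _ ga≢gb) (merge-u≡merge-v u v u≢v)) {x} {x′}
    ; ker₂₁       = λ {x x′} → merge²-factor u≢v {a} {b} ga≢gb g₁ (merge-u≡merge-v _ _ hu≢hv)
                                   (cong (merge _ _ hu≢hv) (merge-u≡merge-v a b a≢b)) {x} {x′}
    }

  mC mk′ : Fin (suc m) → Mark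
  mC  = contractMarks mk a b
  mk′ = absorbMarks mk u v

  mA mB : Fin m → Mark
  mA = absorbMarks mC (h u) (h v)
  mB = contractMarks mk′ (g a) (g b)

  joins-contract : ∀ {k} (es : Vec (Fin (suc (suc m)) × Fin (suc (suc m))) k) (j : Fin k) →
                   Joins u v (lookup es j) → Joins (h u) (h v) (lookup (contractEdges a b a≢b es) j)
  joins-contract es j uv =
    subst (Joins (h u) (h v)) (sym (lookup-map j _ es)) (Sum.map (cong (mapEdge h)) (cong (mapEdge h)) uv)

  absorbable-contract : ∀ {k} (es : Vec (Fin (suc (suc m)) × Fin (suc (suc m))) k) →
                        AbsorbableVertex (graph mk es) v →
                        AbsorbableVertex (graph mC (contractEdges a b a≢b es)) (h v)
  absorbable-contract es (deg , w≡1 , d≡0) =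
    trans (degree-map h refl h-fibre-v es) deg , trans (cong w mC-v) w≡1 , trans (cong d mC-v) d≡0
    where
    mC-v : mC (h v) ≡ mk v
    mC-v = mergeMarks-∉ a b a≢b mk _ v∉ab

  private
    -- the classes of u under g₁ and of a under g₂
    JoinedToU JoinedToA : Fin (suc (suc m)) → Set
    JoinedToU x = x ∈₂ (u , v) ⊎ (x ∈₂ (a , b) × u ∈₂ (a , b))
    JoinedToA x = x ∈₂ (a , b) ⊎ (x ∈₂ (u , v) × u ∈₂ (a , b))

    h-∈ : ∀ {x} → JoinedToU x → h x ∈₂ (h u , h v)
    h-∈ (inj₁ (inj₁ refl))    = inj₁ refl
    h-∈ (inj₁ (inj₂ refl))    = inj₂ refl
    h-∈ (inj₂ (x∈ , u∈))      = inj₁ (trans (merge-∈₂ a b a≢b x∈) (sym (merge-∈₂ a b a≢b u∈)))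

    h-∈⁻ : ∀ {x} → h x ∈₂ (h u , h v) → JoinedToU x
    h-∈⁻ (inj₁ e) with merge-kernel a b a≢b e
    ... | inj₁ x≡u       = inj₁ (inj₁ x≡u)
    ... | inj₂ (x∈ , u∈) = inj₂ (x∈ , u∈)
    h-∈⁻ (inj₂ e)        = inj₁ (inj₂ (h-fibre-v e))

    g-∈ : ∀ {x} → JoinedToA x → g x ∈₂ (g a , g b)
    g-∈ (inj₁ (inj₁ refl))         = inj₁ refl
    g-∈ (inj₁ (inj₂ refl))         = inj₂ refl
    g-∈ (inj₂ (x∈ , inj₁ refl))    = inj₁ (merge-∈₂ u v u≢v x∈)
    g-∈ (inj₂ (x∈ , inj₂ refl))    = inj₂ (merge-∈₂ u v u≢v x∈)

    u∈-from : ∀ {y} → y ∈₂ (u , v) → y ∈₂ (a , b) → u ∈₂ (a , b)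
    u∈-from (inj₁ refl) y∈ = y∈
    u∈-from (inj₂ refl) y∈ = contradiction y∈ v∉ab

    g-∈⁻ : ∀ {x} → g x ∈₂ (g a , g b) → JoinedToA x
    g-∈⁻ {x} (inj₁ e) with merge-kernel u v u≢v e
    ... | inj₁ x≡a       = inj₁ (inj₁ x≡a)
    ... | inj₂ (x∈ , a∈) = inj₂ (x∈ , u∈-from a∈ (inj₁ refl))
    g-∈⁻ {x} (inj₂ e) with merge-kernel u v u≢v e
    ... | inj₁ x≡b       = inj₁ (inj₂ x≡b)
    ... | inj₂ (x∈ , b∈) = inj₂ (x∈ , u∈-from b∈ (inj₂ refl))

    mA-joined : ∀ {x} → JoinedToU x → mA (g₁ x) ≡ bump (mC (h u))
    mA-joined J = mergeMarks-∈ _ _ hu≢hv mC _ (h-∈ J)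

    mA-apart : ∀ {x} → ¬ JoinedToU x → mA (g₁ x) ≡ mC (h x)
    mA-apart ¬J = mergeMarks-∉ _ _ hu≢hv mC _ (¬J ∘ h-∈⁻)

    mB-joined : ∀ {x} → JoinedToA x → mB (g₂ x) ≡ mk′ (g a) ∔ mk′ (g b)
    mB-joined J = mergeMarks-∈ _ _ ga≢gb mk′ _ (g-∈ J)

    mB-apart : ∀ {x} → ¬ JoinedToA x → mB (g₂ x) ≡ mk′ (g x)
    mB-apart ¬J = mergeMarks-∉ _ _ ga≢gb mk′ _ (¬J ∘ g-∈⁻)

    mk′-∉ : ∀ {x} → ¬ x ∈₂ (u , v) → mk′ (g x) ≡ mk x
    mk′-∉ = mergeMarks-∉ u v u≢v mk _

    mC-∉ : ∀ {x} → ¬ x ∈₂ (a , b) → mC (h x) ≡ mk x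
    mC-∉ = mergeMarks-∉ a b a≢b mk _

    absorbed-pair : u ∈₂ (a , b) → mk′ (g a) ∔ mk′ (g b) ≡ bump (mk a ∔ mk b)
    absorbed-pair (inj₁ refl) = trans (cong₂ _∔_ (mergeMarks-∈ u v u≢v mk _ (inj₁ refl)) (mk′-∉ b∉uv))
                                      (bump-∔ˡ (mk a) (mk b))
      where
      b∉uv : ¬ b ∈₂ (a , v)
      b∉uv (inj₁ b≡a) = a≢b (sym b≡a)
      b∉uv (inj₂ b≡v) = v∉ab (inj₂ (sym b≡v))
    absorbed-pair (inj₂ refl) = trans (cong₂ _∔_ (mk′-∉ a∉uv) (mergeMarks-∈ u v u≢v mk _ (inj₁ refl)))
                                      (bump-∔ʳ (mk a) (mk b))
      where
      a∉uv : ¬ a ∈₂ (b , v)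
      a∉uv (inj₁ a≡b) = a≢b a≡b
      a∉uv (inj₂ a≡v) = v∉ab (inj₁ (sym a≡v))

    untouched-pair : ¬ u ∈₂ (a , b) → mk′ (g a) ∔ mk′ (g b) ≡ mk a ∔ mk b
    untouched-pair u∉ab = cong₂ _∔_ (mk′-∉ (λ a∈ → u∉ab (u∈-from a∈ (inj₁ refl))))
                                    (mk′-∉ (λ b∈ → u∉ab (u∈-from b∈ (inj₂ refl))))


    ¬joinedToU : ∀ {x} → ¬ x ∈₂ (u , v) → ¬ (x ∈₂ (a , b) × u ∈₂ (a , b)) → ¬ JoinedToU x
    ¬joinedToU x∉uv _  (inj₁ x∈uv) = x∉uv x∈uv
    ¬joinedToU _    ¬J (inj₂ J)    = ¬J J

    ¬joinedToA : ∀ {x} → ¬ x ∈₂ (a , b) → ¬ (x ∈₂ (u , v) × u ∈₂ (a , b)) → ¬ JoinedToA x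
    ¬joinedToA x∉ab _  (inj₁ x∈ab) = x∉ab x∈ab
    ¬joinedToA _    ¬J (inj₂ J)    = ¬J J

    mA-joined-u∈ab : ∀ {x} → u ∈₂ (a , b) → JoinedToU x → mA (g₁ x) ≡ bump (mk a ∔ mk b)
    mA-joined-u∈ab u∈ab J = trans (mA-joined J) (cong bump (mergeMarks-∈ a b a≢b mk _ u∈ab))

  marks-commute : ∀ x → mB (g₂ x) ≡ mA (g₁ x)
  marks-commute x with u ∈₂? (a , b) | x ∈₂? (u , v) | x ∈₂? (a , b)
  ... | yes u∈ab | yes x∈uv | _        =
    trans (mB-joined (inj₂ (x∈uv , u∈ab)))
          (trans (absorbed-pair u∈ab) (sym (mA-joined-u∈ab u∈ab (inj₁ x∈uv))))
  ... | yes u∈ab | no  _    | yes x∈ab =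
    trans (mB-joined (inj₁ x∈ab))
          (trans (absorbed-pair u∈ab) (sym (mA-joined-u∈ab u∈ab (inj₂ (x∈ab , u∈ab)))))
  ... | no  u∉ab | yes x∈uv | _        =
    trans (mB-apart (¬joinedToA (u∉ab ∘ u∈-from x∈uv) (u∉ab ∘ proj₂)))
          (trans (mergeMarks-∈ u v u≢v mk _ x∈uv) (sym (trans (mA-joined (inj₁ x∈uv)) (cong bump (mC-∉ u∉ab)))))
  ... | no  u∉ab | no  x∉uv | yes x∈ab =
    trans (mB-joined (inj₁ x∈ab)) (trans (untouched-pair u∉ab)
      (sym (trans (mA-apart (¬joinedToU x∉uv (u∉ab ∘ proj₂))) (mergeMarks-∈ a b a≢b mk _ x∈ab))))
  ... | _        | no  x∉uv | no  x∉ab =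
    trans (mB-apart (¬joinedToA x∉ab (x∉uv ∘ proj₁)))
      (trans (mk′-∉ x∉uv) (sym (trans (mA-apart (¬joinedToU x∉uv (x∉ab ∘ proj₁))) (mC-∉ x∉ab))))

-- The M-polynomial over a commutative ring
module _ {c ℓ : Level} (R : CommutativeRing c ℓ) where
  open CommutativeRing R
    using (Carrier; _≈_; _+_; _*_; -_; 0#; 1#; setoid; reflexive; +-cong; *-cong; *-congˡ; *-congʳ;
           +-congˡ; +-congʳ; +-assoc; +-comm; +-identityˡ; +-identityʳ; *-identityˡ; *-identityʳ;
           zeroˡ; zeroʳ; *-assoc; distribˡ; -‿inverseˡ; ring; *-commutativeMonoid; commutativeSemiring)
    renaming (refl to ≈-refl; sym to ≈-sym; trans to ≈-trans)
  open Poly R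
  open import Relation.Binary.Reasoning.Setoid setoid
  open NatCoeffSolver commutativeSemiring using (solve; _:=_; _:+_; _:*_)
  open RingProperties ring using (-1*x≈-x)
  private
    module ∏ = MonoidSum *-commutativeMonoid

  prodFin≡∏ : ∀ {n} (f : Fin n → Carrier) → prodFin f ≡ ∏.sum f
  prodFin≡∏ {zero}  f = refl
  prodFin≡∏ {suc n} f = cong (f zero *_) (prodFin≡∏ (f ∘ suc))

  prodFin-cong : ∀ {n} {f g : Fin n → Carrier} → (∀ i → f i ≈ g i) → prodFin f ≈ prodFin g
  prodFin-cong {zero}  f≈g = ≈-refl
  prodFin-cong {suc n} f≈g = *-cong (f≈g zero) (prodFin-cong (f≈g ∘ suc))

  prodFin-permute : ∀ {n} (f : Fin n → Carrier) (σ : Permutation′ n) →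
                    prodFin f ≈ prodFin (f ∘ (σ ⟨$⟩ʳ_))
  prodFin-permute f σ = begin
    prodFin f                 ≡⟨ prodFin≡∏ f ⟩
    ∏.sum f                   ≈⟨ ∏.sum-permute f σ ⟩
    ∏.sum (f ∘ (σ ⟨$⟩ʳ_))     ≡⟨ sym (prodFin≡∏ (f ∘ (σ ⟨$⟩ʳ_))) ⟩
    prodFin (f ∘ (σ ⟨$⟩ʳ_))   ∎

  prodFin-split : ∀ {n} (c : Carrier) {f f⁺ f⁻ : Fin n → Carrier} (x : Fin n) →
                  (∀ {i} → i ≢ x → f⁺ i ≡ f i) → (∀ {i} → i ≢ x → f⁻ i ≡ f i) →
                  f x ≈ f⁺ x + c * f⁻ x → prodFin f ≈ prodFin f⁺ + c * prodFin f⁻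
  prodFin-split {suc n} c {f} {f⁺} {f⁻} zero off⁺ off⁻ split = begin
    f zero * prodFin (f ∘ suc)
      ≈⟨ *-congʳ split ⟩
    (f⁺ zero + c * f⁻ zero) * prodFin (f ∘ suc)
      ≈⟨ distrib (f⁺ zero) (f⁻ zero) _ ⟩
    f⁺ zero * prodFin (f ∘ suc) + c * (f⁻ zero * prodFin (f ∘ suc))
      ≈⟨ +-cong (*-congˡ tail⁺) (*-congˡ (*-congˡ tail⁻)) ⟩
    f⁺ zero * prodFin (f⁺ ∘ suc) + c * (f⁻ zero * prodFin (f⁻ ∘ suc)) ∎
    where
    distrib : ∀ a b p → (a + c * b) * p ≈ a * p + c * (b * p)
    distrib = solve 4 (λ c a b p → (a :+ c :* b) :* p := a :* p :+ c :* (b :* p)) ≈-refl c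
    tail⁺ : prodFin (f ∘ suc) ≈ prodFin (f⁺ ∘ suc)
    tail⁺ = prodFin-cong (λ i → reflexive (sym (off⁺ {suc i} λ ())))
    tail⁻ : prodFin (f ∘ suc) ≈ prodFin (f⁻ ∘ suc)
    tail⁻ = prodFin-cong (λ i → reflexive (sym (off⁻ {suc i} λ ())))
  prodFin-split {suc n} c {f} {f⁺} {f⁻} (suc x) off⁺ off⁻ split = begin
    f zero * prodFin (f ∘ suc)
      ≈⟨ *-congˡ (prodFin-split c x (off⁺ ∘ (_∘ suc-injective)) (off⁻ ∘ (_∘ suc-injective)) split) ⟩
    f zero * (prodFin (f⁺ ∘ suc) + c * prodFin (f⁻ ∘ suc))
      ≈⟨ distrib (f zero) _ _ ⟩
    f zero * prodFin (f⁺ ∘ suc) + c * (f zero * prodFin (f⁻ ∘ suc))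
      ≡⟨ cong₂ (λ s t → s * prodFin (f⁺ ∘ suc) + c * (t * prodFin (f⁻ ∘ suc)))
               (sym (off⁺ {zero} λ ())) (sym (off⁻ {zero} λ ())) ⟩
    f⁺ zero * prodFin (f⁺ ∘ suc) + c * (f⁻ zero * prodFin (f⁻ ∘ suc)) ∎
    where
    distrib : ∀ p a b → p * (a + c * b) ≈ p * a + c * (p * b)
    distrib = solve 4 (λ c p a b → p :* (a :+ c :* b) := p :* a :+ c :* (p :* b)) ≈-refl c

  sumTo-cong : ∀ d {f g : ℕ → Carrier} → (∀ i → f i ≈ g i) → sumTo d f ≈ sumTo d g
  sumTo-cong zero    f≈g = f≈g 0
  sumTo-cong (suc d) f≈g = +-cong (sumTo-cong d f≈g) (f≈g (suc d))

  sumTo-shift : ∀ d (f : ℕ → Carrier) → sumTo (suc d) f ≈ f 0 + sumTo d (f ∘ suc)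
  sumTo-shift zero    f = ≈-refl
  sumTo-shift (suc d) f = ≈-trans (+-congʳ (sumTo-shift d f)) (+-assoc _ _ _)

  sumTo-+ : ∀ d (f g : ℕ → Carrier) → sumTo d (λ i → f i + g i) ≈ sumTo d f + sumTo d g
  sumTo-+ zero    f g = ≈-refl
  sumTo-+ (suc d) f g = ≈-trans (+-congʳ (sumTo-+ d f g))
    (solve 4 (λ a b x y → (a :+ b) :+ (x :+ y) := (a :+ x) :+ (b :+ y)) ≈-refl _ _ _ _)

  sumTo-* : ∀ d (k : Carrier) (f : ℕ → Carrier) → sumTo d (λ i → k * f i) ≈ k * sumTo d f
  sumTo-* zero    k f = ≈-refl
  sumTo-* (suc d) k f = ≈-trans (+-congʳ (sumTo-* d k f)) (≈-sym (distribˡ k _ _))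

  fromℕ-+ : ∀ a b → fromℕ (a ℕ.+ b) ≈ fromℕ a + fromℕ b
  fromℕ-+ zero    b = ≈-sym (+-identityˡ _)
  fromℕ-+ (suc a) b = ≈-trans (+-congˡ (fromℕ-+ a b)) (≈-sym (+-assoc _ _ _))

  module _ (z : ℕ → ℕ → Carrier) where

    private
      z₁₀ = z 1 0
      term : ℕ → ℕ → ℕ → Carrier
      term w′ d′ i = pow (- 1#) i * fromℕ (d′ C i) * z (w′ ∸ i) 0 * pow z₁₀ i

      term-pascal : ∀ W D i →
                    term (suc W) (suc D) (suc i) ≈ (- 1# * z₁₀) * term W D i + term (suc W) D (suc i)
      term-pascal W D i = begin
        pow (- 1#) (suc i) * fromℕ (suc D C suc i) * z (W ∸ i) 0 * pow z₁₀ (suc i)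
          ≡⟨ cong (λ t → pow (- 1#) (suc i) * fromℕ t * z (W ∸ i) 0 * pow z₁₀ (suc i))
                  (sym (nCk+nC[k+1]≡[n+1]C[k+1] D i)) ⟩
        pow (- 1#) (suc i) * fromℕ (D C i ℕ.+ D C suc i) * z (W ∸ i) 0 * pow z₁₀ (suc i)
          ≈⟨ *-congʳ (*-congʳ (*-congˡ (fromℕ-+ (D C i) (D C suc i)))) ⟩
        - 1# * pow (- 1#) i * (fromℕ (D C i) + fromℕ (D C suc i)) * z (W ∸ i) 0 * (z₁₀ * pow z₁₀ i)
          ≈⟨ solve 7 (λ m p a b zw zz q → m :* p :* (a :+ b) :* zw :* (zz :* q)
                                           := m :* zz :* (p :* a :* zw :* q) :+ m :* p :* b :* zw :* (zz :* q))
                     ≈-refl (- 1#) (pow (- 1#) i) (fromℕ (D C i)) (fromℕ (D C suc i))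
                            (z (W ∸ i) 0) z₁₀ (pow z₁₀ i) ⟩
        (- 1# * z₁₀) * term W D i + term (suc W) D (suc i) ∎

      term-vanishes : ∀ W D → term W D (suc D) ≈ 0#
      term-vanishes W D = begin
        pow (- 1#) (suc D) * fromℕ (D C suc D) * z (W ∸ suc D) 0 * pow z₁₀ (suc D)
          ≡⟨ cong (λ t → pow (- 1#) (suc D) * fromℕ t * z (W ∸ suc D) 0 * pow z₁₀ (suc D))
                  (k>n⇒nCk≡0 (ℕₚ.n<1+n D)) ⟩
        pow (- 1#) (suc D) * 0# * z (W ∸ suc D) 0 * pow z₁₀ (suc D)
          ≈⟨ ≈-trans (*-congʳ (≈-trans (*-congʳ (zeroʳ _)) (zeroˡ _))) (zeroˡ _) ⟩
        0# ∎

    Dbullet-recurrence : ∀ W D → Dbullet z (suc W) D ≈ Dbullet z (suc W) (suc D) + z₁₀ * Dbullet z W D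
    Dbullet-recurrence W D = begin
      sumTo D (term (suc W) D)
        ≈⟨ ≈-sym (≈-trans (+-congˡ (term-vanishes (suc W) D)) (+-identityʳ _)) ⟩
      sumTo (suc D) (term (suc W) D)
        ≈⟨ sumTo-shift D _ ⟩
      t₀ + X
        ≈⟨ +-congˡ (≈-sym (≈-trans (+-congˡ cancel) (+-identityʳ X))) ⟩
      t₀ + (X + ((- 1# * z₁₀) * S + z₁₀ * S))
        ≈⟨ solve 5 (λ t₀ X n S z → t₀ :+ (X :+ (n :* S :+ z :* S)) := (t₀ :+ (n :* S :+ X)) :+ z :* S)
                   ≈-refl t₀ X (- 1# * z₁₀) S z₁₀ ⟩
      (t₀ + ((- 1# * z₁₀) * S + X)) + z₁₀ * S
        ≈⟨ +-congʳ (≈-sym expand) ⟩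
      sumTo (suc D) (term (suc W) (suc D)) + z₁₀ * S ∎
      where
      S  = sumTo D (term W D)
      X  = sumTo D (term (suc W) D ∘ suc)
      t₀ = term (suc W) D 0
      cancel : (- 1# * z₁₀) * S + z₁₀ * S ≈ 0#
      cancel = ≈-trans (+-congʳ (≈-trans (*-assoc _ _ _) (-1*x≈-x _))) (-‿inverseˡ _)
      expand : sumTo (suc D) (term (suc W) (suc D)) ≈ t₀ + ((- 1# * z₁₀) * S + X)
      expand = begin
        sumTo (suc D) (term (suc W) (suc D))
          ≈⟨ sumTo-shift D _ ⟩
        t₀ + sumTo D (term (suc W) (suc D) ∘ suc)
          ≈⟨ +-congˡ (sumTo-cong D (term-pascal W D)) ⟩
        t₀ + sumTo D (λ i → (- 1# * z₁₀) * term W D i + term (suc W) D (suc i))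
          ≈⟨ +-congˡ (≈-trans (sumTo-+ D _ _) (+-congʳ (sumTo-* D _ _))) ⟩
        t₀ + ((- 1# * z₁₀) * S + X) ∎


  module _ (z : ℕ → ℕ → Carrier) (y : Carrier) where

    zMark : Mark → Carrier
    zMark μ = z (w μ) (d μ)

    private
      Mᶻ : ∀ {n} k → (Fin n → Mark) → Vec (Fin n × Fin n) k → Carrier
      Mᶻ = Mev z y

    Mev-loop : ∀ {m k} (mk : Fin (suc m) → Mark) {a b} (es : Vec _ k) → a ≡ b →
               Mᶻ (suc k) mk ((a , b) ∷ es) ≡ y * Mᶻ k mk es
    Mev-loop mk {a} {b} es a≡b with a ≟ b
    ... | yes _   = refl
    ... | no  a≢b = contradiction a≡b a≢b

    Mev-nonloop : ∀ {m k} (mk : Fin (suc m) → Mark) {a b} (es : Vec _ k) (a≢b : a ≢ b) →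
                  Mᶻ (suc k) mk ((a , b) ∷ es) ≡
                  Mᶻ k mk es + Mᶻ k (contractMarks mk a b) (contractEdges a b a≢b es)
    Mev-nonloop mk {a} {b} es a≢b with a ≟ b
    ... | yes a≡b = contradiction a≡b a≢b
    ... | no  a≢b′ = cong (λ es′ → Mᶻ _ mk es + Mᶻ _ (contractMarks mk a b) es′)
                          (map-cong (λ (x , x′) → cong₂ _,_ (merge-irrelevant a b a≢b′ a≢b x)
                                                             (merge-irrelevant a b a≢b′ a≢b x′)) es)

    Mev-sameQuotient : ∀ k {N N′} {g₁ g₂ : Fin N → Fin N′} → SameQuotient g₁ g₂ →
                 {mA mB : Fin N′ → Mark} → (∀ x → mB (g₂ x) ≡ mA (g₁ x)) →
                 (E : Vec (Fin N × Fin N) k) →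
                 Mᶻ k mA (map (mapEdge g₁) E) ≈ Mᶻ k mB (map (mapEdge g₂) E)
    Mev-sameQuotient zero Q {mA} {mB} marks [] = begin
      prodFin (zMark ∘ mA)              ≈⟨ prodFin-cong (λ i → reflexive (cong zMark (sym (marks-σ i)))) ⟩
      prodFin (zMark ∘ mB ∘ (σ ⟨$⟩ʳ_))  ≈⟨ ≈-sym (prodFin-permute (zMark ∘ mB) σ) ⟩
      prodFin (zMark ∘ mB)              ∎
      where
      open SameQuotient Q
      σ = kernelPermutation Q
      marks-σ : ∀ i → mB (σ ⟨$⟩ʳ i) ≡ mA i
      marks-σ i = trans (marks (section₁ i)) (cong mA (g₁∘section₁ i))
    Mev-sameQuotient (suc k) {N′ = zero} {g₁} Q marks ((a , b) ∷ E) with g₁ a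
    ... | ()
    Mev-sameQuotient (suc k) {N′ = suc _} {g₁} {g₂} Q {mA} {mB} marks ((a , b) ∷ E) = cases (g₁ a ≟ g₁ b)
      where
      open SameQuotient Q
      cases : Dec (g₁ a ≡ g₁ b) →
              Mᶻ (suc k) mA ((g₁ a , g₁ b) ∷ map (mapEdge g₁) E) ≈
              Mᶻ (suc k) mB ((g₂ a , g₂ b) ∷ map (mapEdge g₂) E)
      cases (yes e) = begin
        Mᶻ (suc k) mA ((g₁ a , g₁ b) ∷ map (mapEdge g₁) E) ≡⟨ Mev-loop mA _ e ⟩
        y * Mᶻ k mA (map (mapEdge g₁) E)                   ≈⟨ *-congˡ (Mev-sameQuotient k Q marks E) ⟩
        y * Mᶻ k mB (map (mapEdge g₂) E)                   ≡⟨ sym (Mev-loop mB _ (ker₁₂ e)) ⟩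
        Mᶻ (suc k) mB ((g₂ a , g₂ b) ∷ map (mapEdge g₂) E) ∎
      cases (no p₁) = begin
        Mᶻ (suc k) mA ((g₁ a , g₁ b) ∷ map (mapEdge g₁) E)
          ≡⟨ Mev-nonloop mA _ p₁ ⟩
        Mᶻ k mA (map (mapEdge g₁) E) + Mᶻ k mA′ (contractEdges (g₁ a) (g₁ b) p₁ (map (mapEdge g₁) E))
          ≡⟨ cong (λ es → Mᶻ k mA (map (mapEdge g₁) E) + Mᶻ k mA′ es) (sym (map-∘ _ _ E)) ⟩
        Mᶻ k mA (map (mapEdge g₁) E) + Mᶻ k mA′ (map (mapEdge (merge (g₁ a) (g₁ b) p₁ ∘ g₁)) E)
          ≈⟨ +-cong (Mev-sameQuotient k Q marks E)
                    (Mev-sameQuotient k (SameQuotient-contract Q p₁ p₂)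
                                        (contractMarks-compatible Q p₁ p₂ marks) E) ⟩
        Mᶻ k mB (map (mapEdge g₂) E) + Mᶻ k mB′ (map (mapEdge (merge (g₂ a) (g₂ b) p₂ ∘ g₂)) E)
          ≡⟨ cong (λ es → Mᶻ k mB (map (mapEdge g₂) E) + Mᶻ k mB′ es) (map-∘ _ _ E) ⟩
        Mᶻ k mB (map (mapEdge g₂) E) + Mᶻ k mB′ (contractEdges (g₂ a) (g₂ b) p₂ (map (mapEdge g₂) E))
          ≡⟨ sym (Mev-nonloop mB _ p₂) ⟩
        Mᶻ (suc k) mB ((g₂ a , g₂ b) ∷ map (mapEdge g₂) E) ∎
        where
        mA′ = contractMarks mA (g₁ a) (g₁ b)
        mB′ = contractMarks mB (g₂ a) (g₂ b)
        p₂ : g₂ a ≢ g₂ b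
        p₂ = p₁ ∘ ker₂₁

    Mev-permute : ∀ k {n} (σ : Permutation′ n) {mk mk′ : Fin n → Mark} →
                  (∀ x → mk′ (σ ⟨$⟩ʳ x) ≡ mk x) →
                  (es : Vec (Fin n × Fin n) k) → Mᶻ k mk es ≈ Mᶻ k mk′ (map (mapEdge (σ ⟨$⟩ʳ_)) es)
    Mev-permute k σ {mk} marks es =
      ≈-trans (reflexive (cong (Mᶻ k mk) (sym (map-id es))))
              (Mev-sameQuotient k (SameQuotient-permutation σ) marks es)

    Mev-cong-marks : ∀ k {n} {mk mk′ : Fin n → Mark} → (∀ x → mk′ x ≡ mk x) →
                     (es : Vec (Fin n × Fin n) k) → Mᶻ k mk es ≈ Mᶻ k mk′ es
    Mev-cong-marks k {mk′ = mk′} marks es =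
      ≈-trans (Mev-permute k Perm.id marks es) (reflexive (cong (Mᶻ k mk′) (map-id es)))

    Mev-suc : ∀ k {n} (mk : Fin (suc n) → Mark) (E : Vec (Fin n × Fin n) k) →
              Mᶻ k mk (map (mapEdge suc) E) ≈ zMark (mk zero) * Mᶻ k (mk ∘ suc) E
    Mev-suc zero    mk []                 = ≈-refl
    Mev-suc (suc k) {zero} mk ((() , _) ∷ E)
    Mev-suc (suc k) {suc n} mk ((a , b) ∷ E) = cases (a ≟ b)
      where
      z₀ = zMark (mk zero)
      cases : Dec (a ≡ b) →
              Mᶻ (suc k) mk ((suc a , suc b) ∷ map (mapEdge suc) E) ≈ z₀ * Mᶻ (suc k) (mk ∘ suc) ((a , b) ∷ E)
      cases (yes a≡b) = begin
        Mᶻ (suc k) mk ((suc a , suc b) ∷ map (mapEdge suc) E) ≡⟨ Mev-loop mk _ (cong suc a≡b) ⟩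
        y * Mᶻ k mk (map (mapEdge suc) E)                    ≈⟨ *-congˡ (Mev-suc k mk E) ⟩
        y * (z₀ * Mᶻ k (mk ∘ suc) E)
          ≈⟨ solve 3 (λ y z₀ m → y :* (z₀ :* m) := z₀ :* (y :* m)) ≈-refl y z₀ _ ⟩
        z₀ * (y * Mᶻ k (mk ∘ suc) E)                         ≡⟨ cong (z₀ *_) (sym (Mev-loop (mk ∘ suc) E a≡b)) ⟩
        z₀ * Mᶻ (suc k) (mk ∘ suc) ((a , b) ∷ E)             ∎
      cases (no a≢b) = begin
        Mᶻ (suc k) mk ((suc a , suc b) ∷ map (mapEdge suc) E)
          ≡⟨ Mev-nonloop mk _ sa≢sb ⟩
        Mᶻ k mk (map (mapEdge suc) E) + Mᶻ k mk′ (contractEdges (suc a) (suc b) sa≢sb (map (mapEdge suc) E))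
          ≡⟨ cong (λ es → Mᶻ k mk (map (mapEdge suc) E) + Mᶻ k mk′ es) contract-suc ⟩
        Mᶻ k mk (map (mapEdge suc) E) + Mᶻ k mk′ (map (mapEdge suc) (contractEdges a b a≢b E))
          ≈⟨ +-cong (Mev-suc k mk E) (Mev-suc k mk′ _) ⟩
        z₀ * Mᶻ k (mk ∘ suc) E + zMark (mk′ zero) * Mᶻ k (mk′ ∘ suc) (contractEdges a b a≢b E)
          ≈⟨ +-congˡ (*-cong (reflexive (cong zMark (mergeMarks-zero mk a b N)))
                             (Mev-cong-marks k (λ i → sym (mergeMarks-suc mk a b N i)) _)) ⟩
        z₀ * Mᶻ k (mk ∘ suc) E + z₀ * Mᶻ k (contractMarks (mk ∘ suc) a b) (contractEdges a b a≢b E)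
          ≈⟨ ≈-sym (distribˡ z₀ _ _) ⟩
        z₀ * (Mᶻ k (mk ∘ suc) E + Mᶻ k (contractMarks (mk ∘ suc) a b) (contractEdges a b a≢b E))
          ≡⟨ cong (z₀ *_) (sym (Mev-nonloop (mk ∘ suc) E a≢b)) ⟩
        z₀ * Mᶻ (suc k) (mk ∘ suc) ((a , b) ∷ E) ∎
        where
        sa≢sb : suc a ≢ suc b
        sa≢sb = a≢b ∘ suc-injective
        N   = mk (suc a) ∔ mk (suc b)
        mk′ = contractMarks mk (suc a) (suc b)
        contract-suc : contractEdges (suc a) (suc b) sa≢sb (map (mapEdge suc) E) ≡
                       map (mapEdge suc) (contractEdges a b a≢b E)
        contract-suc = trans (sym (map-∘ _ _ E))
          (trans (map-cong (λ (x , x′) → cong₂ _,_ (merge-suc a≢b sa≢sb x) (merge-suc a≢b sa≢sb x′)) E)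
                 (map-∘ _ _ E))

    Mev-isolated : ∀ k {m} (mk : Fin (suc m) → Mark) (v : Fin (suc m)) (E : Vec (Fin m × Fin m) k) →
                   Mᶻ k mk (map (mapEdge (punchIn v)) E) ≈ zMark (mk v) * Mᶻ k (mk ∘ punchIn v) E
    Mev-isolated k mk v E = begin
      Mᶻ k mk (map (mapEdge (punchIn v)) E)
        ≈⟨ Mev-permute k σ (λ x → cong mk (inverseˡ σ)) _ ⟩
      Mᶻ k (mk ∘ (σ ⟨$⟩ˡ_)) (map (mapEdge (σ ⟨$⟩ʳ_)) (map (mapEdge (punchIn v)) E))
        ≡⟨ cong (Mᶻ k (mk ∘ (σ ⟨$⟩ˡ_))) σ∘punchIn ⟩
      Mᶻ k (mk ∘ (σ ⟨$⟩ˡ_)) (map (mapEdge suc) E)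
        ≈⟨ Mev-suc k (mk ∘ (σ ⟨$⟩ˡ_)) E ⟩
      zMark (mk v) * Mᶻ k (mk ∘ punchIn v) E ∎
      where
      -- σ sends v to zero and punchIn v i to suc i
      σ : Permutation′ _
      σ = Perm.insert v zero Perm.id
      σ∘punchIn : map (mapEdge (σ ⟨$⟩ʳ_)) (map (mapEdge (punchIn v)) E) ≡ map (mapEdge suc) E
      σ∘punchIn = trans (sym (map-∘ _ _ E))
                        (map-cong (λ (x , x′) → cong₂ _,_ (inverseʳ σ) (inverseʳ σ)) E)

    module _ (c : Carrier)
             (zMark-split : ∀ {μ μ⁺ μ⁻} → Split μ μ⁺ μ⁻ → zMark μ ≈ zMark μ⁺ + c * zMark μ⁻) where

      Mev-split : ∀ k {n} {mk mk⁺ mk⁻ : Fin n → Mark} {x} → SplitAt x mk mk⁺ mk⁻ →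
                  (es : Vec (Fin n × Fin n) k) → Mᶻ k mk es ≈ Mᶻ k mk⁺ es + c * Mᶻ k mk⁻ es
      Mev-split zero {mk = mk} {mk⁺} {mk⁻} {x} s [] =
        prodFin-split c x (cong zMark ∘ off⁺) (cong zMark ∘ off⁻) (zMark-split at)
        where open SplitAt s
      Mev-split (suc k) {zero} {x = ()} s es
      Mev-split (suc k) {suc n} {mk} {mk⁺} {mk⁻} s ((a , b) ∷ es) = cases (a ≟ b)
        where
        cases : Dec (a ≡ b) →
                Mᶻ (suc k) mk ((a , b) ∷ es) ≈ Mᶻ (suc k) mk⁺ ((a , b) ∷ es) + c * Mᶻ (suc k) mk⁻ ((a , b) ∷ es)
        cases (yes a≡b) = begin
          Mᶻ (suc k) mk ((a , b) ∷ es)                      ≡⟨ Mev-loop mk es a≡b ⟩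
          y * Mᶻ k mk es                                    ≈⟨ *-congˡ (Mev-split k s es) ⟩
          y * (Mᶻ k mk⁺ es + c * Mᶻ k mk⁻ es)
            ≈⟨ solve 4 (λ y c p q → y :* (p :+ c :* q) := y :* p :+ c :* (y :* q)) ≈-refl y c _ _ ⟩
          y * Mᶻ k mk⁺ es + c * (y * Mᶻ k mk⁻ es)
            ≡⟨ sym (cong₂ (λ s t → s + c * t) (Mev-loop mk⁺ es a≡b) (Mev-loop mk⁻ es a≡b)) ⟩
          Mᶻ (suc k) mk⁺ ((a , b) ∷ es) + c * Mᶻ (suc k) mk⁻ ((a , b) ∷ es) ∎
        cases (no a≢b) = begin
          Mᶻ (suc k) mk ((a , b) ∷ es)
            ≡⟨ Mev-nonloop mk es a≢b ⟩
          Mᶻ k mk es + Mᶻ k (C mk) es′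
            ≈⟨ +-cong (Mev-split k s es) (Mev-split k (SplitAt-contract a≢b s) es′) ⟩
          (Mᶻ k mk⁺ es + c * Mᶻ k mk⁻ es) + (Mᶻ k (C mk⁺) es′ + c * Mᶻ k (C mk⁻) es′)
            ≈⟨ solve 5 (λ c p q p′ q′ → (p :+ c :* q) :+ (p′ :+ c :* q′) := (p :+ p′) :+ c :* (q :+ q′))
                       ≈-refl c _ _ _ _ ⟩
          (Mᶻ k mk⁺ es + Mᶻ k (C mk⁺) es′) + c * (Mᶻ k mk⁻ es + Mᶻ k (C mk⁻) es′)
            ≡⟨ sym (cong₂ (λ s t → s + c * t) (Mev-nonloop mk⁺ es a≢b) (Mev-nonloop mk⁻ es a≢b)) ⟩
          Mᶻ (suc k) mk⁺ ((a , b) ∷ es) + c * Mᶻ (suc k) mk⁻ ((a , b) ∷ es) ∎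
          where
          C : (Fin (suc n) → Mark) → Fin n → Mark
          C mk′ = contractMarks mk′ a b
          es′ = contractEdges a b a≢b es

    Mev-contract-swap : ∀ {m k} (mk : Fin (suc m) → Mark) {u v} (u≢v : u ≢ v)
                        (es : Vec (Fin (suc m) × Fin (suc m)) k) →
                        Mᶻ k (contractMarks mk v u) (contractEdges v u (u≢v ∘ sym) es) ≈
                        Mᶻ k (contractMarks mk u v) (contractEdges u v u≢v es)
    Mev-contract-swap {k = k} mk u≢v = Mev-sameQuotient k (SameQuotient-swap u≢v) (contractMarks-swap mk u≢v)

    Mev-absorb∘contract : ∀ {m k} (mk : Fin (suc (suc m)) → Mark) {a b u v} (a≢b : a ≢ b) (u≢v : u ≢ v)
      (v∉ab : ¬ v ∈₂ (a , b)) (E : Vec (Fin (suc (suc m)) × Fin (suc (suc m))) k) →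
      let open AbsorbContract mk a≢b u≢v v∉ab in
      Mᶻ k mA (contractEdges (h u) (h v) hu≢hv (contractEdges a b a≢b E)) ≈
      Mᶻ k mB (contractEdges (g a) (g b) ga≢gb (contractEdges u v u≢v E))
    Mev-absorb∘contract {k = k} mk {a} {b} {u} {v} a≢b u≢v v∉ab E = begin
      Mᶻ k mA (contractEdges (h u) (h v) hu≢hv (contractEdges a b a≢b E)) ≡⟨ cong (Mᶻ k mA) (sym (map-∘ _ _ E)) ⟩
      Mᶻ k mA (map (mapEdge g₁) E)                                ≈⟨ Mev-sameQuotient k sameQuotient marks-commute E ⟩
      Mᶻ k mB (map (mapEdge g₂) E)                                ≡⟨ cong (Mᶻ k mB) (map-∘ _ _ E) ⟩
      Mᶻ k mB (contractEdges (g a) (g b) ga≢gb (contractEdges u v u≢v E)) ∎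
      where open AbsorbContract mk a≢b u≢v v∉ab

    module _ (recurrence : ∀ W D → z (suc W) D ≈ z (suc W) (suc D) + z 1 0 * z W D) where

      zMark-split : ∀ {μ μ⁺ μ⁻} → Split μ μ⁺ μ⁻ → zMark μ ≈ zMark μ⁺ + z 1 0 * zMark μ⁻
      zMark-split {μ} {μ⁺} {μ⁻} (mkSplit w≡ d≡ w⁺≡ d⁺≡) = begin
        z (w μ) (d μ)                                            ≡⟨ cong₂ z w≡ d≡ ⟩
        z (suc (w μ⁻)) (d μ⁻)                                    ≈⟨ recurrence (w μ⁻) (d μ⁻) ⟩
        z (suc (w μ⁻)) (suc (d μ⁻)) + z 1 0 * z (w μ⁻) (d μ⁻)
          ≡⟨ cong (_+ z 1 0 * z (w μ⁻) (d μ⁻))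
                  (sym (cong₂ z (trans w⁺≡ w≡) (trans d⁺≡ (cong suc d≡)))) ⟩
        z (w μ⁺) (d μ⁺) + z 1 0 * z (w μ⁻) (d μ⁻)                ∎

      Mev-absorb-head : ∀ {m k} (mk : Fin (suc m) → Mark) {u v} (u≢v : u ≢ v)
        (es : Vec (Fin (suc m) × Fin (suc m)) k) →
        degree es v ≡ 0 → w (mk v) ≡ 1 → d (mk v) ≡ 0 →
        Mᶻ k mk es + Mᶻ k (contractMarks mk u v) (contractEdges u v u≢v es) ≈
        Mᶻ k (absorbMarks mk u v) (contractEdges u v u≢v es)
      Mev-absorb-head {k = k} mk {u} {v} u≢v es deg₀ w≡1 d≡0 = begin
        Mᶻ k mk es + Mᶻ k mk⁺ es′
          ≡⟨ cong (λ t → Mᶻ k mk t + Mᶻ k mk⁺ es′) (degree≡0⇒avoids u≢v es deg₀) ⟩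
        Mᶻ k mk (map (mapEdge (punchIn v)) es′) + Mᶻ k mk⁺ es′
          ≈⟨ +-congʳ (Mev-isolated k mk v es′) ⟩
        zMark (mk v) * Mᶻ k (mk ∘ punchIn v) es′ + Mᶻ k mk⁺ es′
          ≈⟨ +-congʳ (*-cong (reflexive (cong₂ z w≡1 d≡0))
                             (Mev-cong-marks k {mk = mk ∘ punchIn v} {mk⁻} (mergeMarks-self mk u≢v) es′)) ⟩
        z 1 0 * Mᶻ k mk⁻ es′ + Mᶻ k mk⁺ es′
          ≈⟨ +-comm _ _ ⟩
        Mᶻ k mk⁺ es′ + z 1 0 * Mᶻ k mk⁻ es′
          ≈⟨ ≈-sym (Mev-split (z 1 0) zMark-split k splitAt es′) ⟩
        Mᶻ k (absorbMarks mk u v) es′ ∎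
        where
        es′ = contractEdges u v u≢v es
        mk⁺ = contractMarks mk u v
        mk⁻ = mergeMarks mk u v (mk u)
        splitAt : SplitAt (merge u v u≢v u) (absorbMarks mk u v) mk⁺ mk⁻
        splitAt = record
          { at    = Split-resp (at-u _) (at-u _) (at-u _) (Split-absorb w≡1 d≡0)
          ; off⁺  = mergeMarks-off mk u≢v _ _
          ; off⁻  = mergeMarks-off mk u≢v _ _
          }
          where
          at-u : ∀ N → N ≡ mergeMarks mk u v N (merge u v u≢v u)
          at-u N = sym (mergeMarks-∈ u v u≢v mk N (inj₁ refl))

      Mev-absorb : ∀ {m k} (mk : Fin (suc m) → Mark) (es : Vec (Fin (suc m) × Fin (suc m)) (suc k))
        (j : Fin (suc k)) {u v} (u≢v : u ≢ v) → Joins u v (lookup es j) → AbsorbableVertex (graph mk es) v →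
        Mᶻ (suc k) mk es ≈ Mᶻ k (absorbMarks mk u v) (contractEdges u v u≢v (removeAt es j))
      Mev-absorb mk (_ ∷ es) zero u≢v uv@(inj₁ refl) (deg , w≡1 , d≡0) =
        ≈-trans (reflexive (Mev-nonloop mk es u≢v))
                (Mev-absorb-head mk u≢v es (pendant-head es u≢v uv deg) w≡1 d≡0)
      Mev-absorb {k = k} mk (_ ∷ es) zero {u} {v} u≢v uv@(inj₂ refl) (deg , w≡1 , d≡0) = begin
        Mᶻ (suc k) mk ((v , u) ∷ es)
          ≡⟨ Mev-nonloop mk es (u≢v ∘ sym) ⟩
        Mᶻ k mk es + Mᶻ k (contractMarks mk v u) (contractEdges v u (u≢v ∘ sym) es)
          ≈⟨ +-congˡ (Mev-contract-swap mk u≢v es) ⟩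
        Mᶻ k mk es + Mᶻ k (contractMarks mk u v) (contractEdges u v u≢v es)
          ≈⟨ Mev-absorb-head mk u≢v es (pendant-head es u≢v uv deg) w≡1 d≡0 ⟩
        Mᶻ k (absorbMarks mk u v) (contractEdges u v u≢v es) ∎
      Mev-absorb {zero} mk (_ ∷ _ ∷ _) (suc j) {zero} {zero} u≢v _ _ = contradiction refl u≢v
      Mev-absorb {suc m} {suc k} mk ((a , b) ∷ es@(_ ∷ _)) (suc j) {u} {v} u≢v uv (deg , w≡1 , d≡0) =
        cases (a ≟ b)
        where
        v∉ab = proj₁ (pendant-tail (a , b) es j u≢v uv deg)
        absorbable-es : AbsorbableVertex (graph mk es) v
        absorbable-es = proj₂ (pendant-tail (a , b) es j u≢v uv deg) , w≡1 , d≡0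
        mk′ = absorbMarks mk u v
        g   = merge u v u≢v
        E   = removeAt es j
        R₀  = contractEdges u v u≢v E
        absorb-es : Mᶻ (suc k) mk es ≈ Mᶻ k mk′ R₀
        absorb-es = Mev-absorb mk es j u≢v uv absorbable-es
        cases : Dec (a ≡ b) → Mᶻ (suc (suc k)) mk ((a , b) ∷ es) ≈ Mᶻ (suc k) mk′ ((g a , g b) ∷ R₀)
        cases (yes a≡b) = begin
          Mᶻ (suc (suc k)) mk ((a , b) ∷ es) ≡⟨ Mev-loop mk es a≡b ⟩
          y * Mᶻ (suc k) mk es               ≈⟨ *-congˡ absorb-es ⟩
          y * Mᶻ k mk′ R₀                    ≡⟨ sym (Mev-loop mk′ R₀ (cong g a≡b)) ⟩
          Mᶻ (suc k) mk′ ((g a , g b) ∷ R₀)  ∎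
        cases (no a≢b) = begin
          Mᶻ (suc (suc k)) mk ((a , b) ∷ es)
            ≡⟨ Mev-nonloop mk es a≢b ⟩
          Mᶻ (suc k) mk es + Mᶻ (suc k) mC es′
            ≈⟨ +-cong absorb-es
                      (Mev-absorb mC es′ j hu≢hv (joins-contract es j uv) (absorbable-contract es absorbable-es)) ⟩
          Mᶻ k mk′ R₀ + Mᶻ k mA (contractEdges (h u) (h v) hu≢hv (removeAt es′ j))
            ≡⟨ cong (λ t → Mᶻ k mk′ R₀ + Mᶻ k mA (contractEdges (h u) (h v) hu≢hv t)) (removeAt-map _ es j) ⟩
          Mᶻ k mk′ R₀ + Mᶻ k mA (contractEdges (h u) (h v) hu≢hv (contractEdges a b a≢b E))
            ≈⟨ +-congˡ (Mev-absorb∘contract mk a≢b u≢v v∉ab E) ⟩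
          Mᶻ k mk′ R₀ + Mᶻ k mB (contractEdges (g a) (g b) ga≢gb R₀)
            ≡⟨ sym (Mev-nonloop mk′ R₀ ga≢gb) ⟩
          Mᶻ (suc k) mk′ ((g a , g b) ∷ R₀) ∎
          where
          open AbsorbContract mk a≢b u≢v v∉ab
            using (h; hu≢hv; ga≢gb; mC; mA; mB; joins-contract; absorbable-contract)
          es′ = contractEdges a b a≢b es

  Dbullet-1-0 : ∀ z → Dbullet z 1 0 ≈ z 1 0
  Dbullet-1-0 z = begin
    1# * (1# + 0#) * z 1 0 * 1#  ≈⟨ *-identityʳ _ ⟩
    1# * (1# + 0#) * z 1 0       ≈⟨ *-congʳ (≈-trans (*-identityˡ _) (+-identityʳ _)) ⟩
    1# * z 1 0                   ≈⟨ *-identityˡ _ ⟩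
    z 1 0                        ∎

  D-absorbStep : ∀ z y {G H} → AbsorbStep G H → D z y G ≈ D z y H
  D-absorbStep z y (absorb mk es j u v u≢v uv absorbable) =
    Mev-absorb (Dbullet z) y recurrence mk es j u≢v uv absorbable
    where
    recurrence : ∀ W D → Dbullet z (suc W) D ≈ Dbullet z (suc W) (suc D) + Dbullet z 1 0 * Dbullet z W D
    recurrence W D = ≈-trans (Dbullet-recurrence z W D) (+-congˡ (*-congʳ (≈-sym (Dbullet-1-0 z))))

-- The identity holds along any sequence of absorptions.
theorem5p8 : ∀ {c ℓ} (R : CommutativeRing c ℓ) (G K : Graph) →
    Star AbsorbStep G K → NoAbsorbable K →
    (z : ℕ → ℕ → CommutativeRing.Carrier R) (y : CommutativeRing.Carrier R) →
    CommutativeRing._≈_ R (Poly.D R z y G) (Poly.D R z y K)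
theorem5p8 R G .G ε          _ z y = CommutativeRing.refl R
theorem5p8 R G K  (step ◅ steps) core z y =
  CommutativeRing.trans R (D-absorbStep R z y step) (theorem5p8 R _ K steps core z y)
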